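{- Let $G$ be a reduced graph. Then every shallow terminal in $G$ is simplicial in $G$; that is, whenever an induced subgraph $W$ of $G$ is a $\dagger$-AW $(s:c:l,B,r)$ or a $\ddagger$-AW $(s:c_1,c_2:l,B,r)$, the neighborhood $N_G(s)$ of its shallow terminal $s$ in $G$ induces a clique.
   Context: Graphs are finite, simple, undirected. A set $X\subseteq V(G)$ is a minimal forbidden set if $G[X]$ is not an interval graph but $G[X']$ is an interval graph for every proper subset $X'\subset X$. A graph is prereduced if it has no minimal forbidden set of at most $10$ vertices. A module is a set $M\subseteq V(G)$ such that every vertex of $M$ has the same neighbors outside $M$; it is nontrivial if $1<|M|<|V(G)|$. A graph is reduced if it is prereduced and every nontrivial module induces a clique. A $\dagger$-AW $(s:c:l,B,r)$ with $B=\{b_1,\dots,b_d\}$, $d\ge 3$, writing $b_0=l$, $b_{d+1}=r$, is the graph on vertices $s,c,b_0,\dots,b_{d+1}$ whose edges are exactly $b_ib_{i+1}$ ($0\le i\le d$), $cs$, and $cb_i$ ($1\le i\le d$). A $\ddagger$-AW $(s:c_1,c_2:l,B,r)$ with $B=\{b_1,\dots,b_d\}$, $d\ge 2$, $b_0=l$, $b_{d+1}=r$, is the graph on $s,c_1,c_2,b_0,\dots,b_{d+1}$ whose edges are exactly $b_ib_{i+1}$ ($0\le i\le d$), $c_1c_2$, $c_1s$, $c_2s$, $c_1l$, $c_2r$, and $c_jb_i$ for $j=1,2$ and $1\le i\le d$. In such a graph, $s$ is the shallow terminal, $l,r$ the base terminals, $c$ (resp. $c_1,c_2$) the center(s), and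 $B$ the base. A vertex is simplicial if its neighborhood induces a clique. -}

module Defs where

open import Data.Bool using (Bool; true; false; _∧_; _∨_)
open import Data.Nat using (ℕ; zero; suc; _≤_; _<_; _≡ᵇ_; _≤ᵇ_)
open import Data.Fin using (Fin; toℕ)
open import Data.Fin.Subset using (Subset; _∈_; _∉_; _⊂_; ∣_∣)
open import Data.Product using (Σ; _×_)
open import Data.Sum using (_⊎_)
open import Relation.Nullary using (¬_)
open import Relation.Binary.PropositionalEquality using (_≡_; _≢_)
open import Function.Definitions using (Injective)

record Graph : Set where
  field
    n      : ℕ
    adj    : Fin n → Fin n → Bool
    sym    : ∀ x y → adj x y ≡ adj y x
    irrefl : ∀ x → adj x x ≡ false

open Graph public

module _ (G : Graph) where

  IsIntervalOn : Subset (n G) → Set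
  IsIntervalOn X =
    Σ (Fin (n G) → ℕ) λ l → Σ (Fin (n G) → ℕ) λ r →
      (∀ x → x ∈ X → l x ≤ r x) ×
      (∀ x y → x ∈ X → y ∈ X → x ≢ y →
        ((adj G x y ≡ true → (l x ≤ r y × l y ≤ r x)) ×
         ((l x ≤ r y × l y ≤ r x) → adj G x y ≡ true)))

  MinimalForbidden : Subset (n G) → Set
  MinimalForbidden X = ¬ IsIntervalOn X × (∀ X′ → X′ ⊂ X → IsIntervalOn X′)

  Prereduced : Set
  Prereduced = ∀ X → ∣ X ∣ ≤ 10 → ¬ MinimalForbidden X

  IsModule : Subset (n G) → Set
  IsModule M = ∀ u v w → u ∈ M → v ∈ M → w ∉ M → adj G u w ≡ adj G v w

  Nontrivial : Subset (n G) → Set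
  Nontrivial M = 1 < ∣ M ∣ × ∣ M ∣ < n G

  IsCliqueSet : Subset (n G) → Set
  IsCliqueSet M = ∀ u v → u ∈ M → v ∈ M → u ≢ v → adj G u v ≡ true

  Reduced : Set
  Reduced = Prereduced × (∀ M → IsModule M → Nontrivial M → IsCliqueSet M)

  Simplicial : Fin (n G) → Set
  Simplicial v = ∀ u w → adj G v u ≡ true → adj G v w ≡ true → u ≢ w → adj G u w ≡ true

-- Base path b_0 = l, b_1..b_d, b_{d+1} = r, indexed by Fin (d+2).
pathAdj : ℕ → ℕ → Bool
pathAdj i j = (j ≡ᵇ suc i) ∨ (i ≡ᵇ suc j)

inner : ℕ → ℕ → Bool
inner d i = (1 ≤ᵇ i) ∧ (i ≤ᵇ d)

-- †-AW (s : c : l , B , r) with |B| = d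
data DagV (d : ℕ) : Set where
  sD : DagV d
  cD : DagV d
  bD : Fin (suc (suc d)) → DagV d

dagAdj : (d : ℕ) → DagV d → DagV d → Bool
dagAdj d sD sD = false
dagAdj d sD cD = true
dagAdj d sD (bD _) = false
dagAdj d cD sD = true
dagAdj d cD cD = false
dagAdj d cD (bD i) = inner d (toℕ i)
dagAdj d (bD _) sD = false
dagAdj d (bD i) cD = inner d (toℕ i)
dagAdj d (bD i) (bD j) = pathAdj (toℕ i) (toℕ j)

-- ‡-AW (s : c₁ , c₂ : l , B , r) with |B| = d
data DDagV (d : ℕ) : Set where
  sE  : DDagV d
  c₁E : DDagV d
  c₂E : DDagV d
  bE  : Fin (suc (suc d)) → DDagV d

ddagAdj : (d : ℕ) → DDagV d → DDagV d → Bool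
ddagAdj d sE sE = false
ddagAdj d sE c₁E = true
ddagAdj d sE c₂E = true
ddagAdj d sE (bE _) = false
ddagAdj d c₁E sE = true
ddagAdj d c₁E c₁E = false
ddagAdj d c₁E c₂E = true
ddagAdj d c₁E (bE i) = inner d (toℕ i) ∨ (toℕ i ≡ᵇ 0)
ddagAdj d c₂E sE = true
ddagAdj d c₂E c₁E = true
ddagAdj d c₂E c₂E = false
ddagAdj d c₂E (bE i) = inner d (toℕ i) ∨ (toℕ i ≡ᵇ suc d)
ddagAdj d (bE _) sE = false
ddagAdj d (bE i) c₁E = inner d (toℕ i) ∨ (toℕ i ≡ᵇ 0)
ddagAdj d (bE i) c₂E = inner d (toℕ i) ∨ (toℕ i ≡ᵇ suc d)
ddagAdj d (bE i) (bE j) = pathAdj (toℕ i) (toℕ j)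

InducedEmbedding : (G : Graph) {V : Set} → (V → V → Bool) → (V → Fin (n G)) → Set
InducedEmbedding G {V} A f = Injective _≡_ _≡_ f × (∀ x y → adj G (f x) (f y) ≡ A x y)

ShallowTerminal : (G : Graph) → Fin (n G) → Set
ShallowTerminal G s =
  (Σ ℕ λ d → 3 ≤ d × Σ (DagV d → Fin (n G)) λ f →
     InducedEmbedding G (dagAdj d) f × f sD ≡ s)
  ⊎
  (Σ ℕ λ d → 2 ≤ d × Σ (DDagV d → Fin (n G)) λ f →
     InducedEmbedding G (ddagAdj d) f × f sE ≡ s)

-- Let C be the centres of the AW and Cand the common neighbours of C that see no base
-- vertex; s is one of them.  Forbidden subgraphs on at most ten vertices (asteroidal
-- triples, 4-holes and 5-holes built from the AW and one or two further vertices) show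
-- that a vertex outside Cand ∪ C that sees a vertex of Cand sees every centre, and then
-- that it cannot see exactly one end of an edge inside Cand.  So the vertices of Cand
-- that no outsider can tell apart from s form a module.  Two non-adjacent neighbours
-- of s would both lie in it, making it a nontrivial module that misses the centres and
-- is not a clique, which reducedness forbids.
module Submission where

open import Defs
open import Data.Bool using (Bool; true; false; _∧_; _∨_; T)
open import Data.Nat using (ℕ; zero; suc; _≤_; _<_; _≡ᵇ_; _≤ᵇ_; z≤n; s≤s; _+_; _≤?_)
import Data.Nat.Properties as ℕ
open import Data.Fin using (Fin; toℕ; _≟_)
import Data.Fin as Fin
open import Data.Fin.Subset using (Subset; _∈_; ∣_∣; ⁅_⁆; _∪_; ⊤) renaming (⊥ to ∅)
open import Data.Product using (Σ; _×_; _,_; proj₁; proj₂)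
open import Data.Sum using (_⊎_; inj₁; inj₂; [_,_]′)
open import Data.Empty using (⊥; ⊥-elim)
open import Relation.Nullary using (¬_; Dec; yes; no)
open import Relation.Nullary.Decidable using (¬?; _×-dec_; _⊎-dec_; _→-dec_; dec-true; isYes≗does; ⌊_⌋; toWitness)
open import Relation.Unary using (Decidable)
import Data.Bool.Properties as Bool
open import Function.Base using (_∘_; id)
open import Function.Bundles using (Equivalence)
open import Function.Definitions using (Injective)
open import Data.List using (List; []; _∷_; length; foldr)
open import Data.List.Membership.Propositional using () renaming (_∈_ to _∈ᴸ_)
open import Data.List.Relation.Unary.Any using (here; there)
open import Data.Vec using ([]; _∷_; tabulate)
open import Data.Vec.Properties using (lookup∘tabulate; []=⇒lookup; lookup⇒[]=)
open import Data.Fin.Properties using (all?; toℕ≤pred[n]; ¬∀⟶∃¬)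
open import Data.Unit using (tt)
open import Data.Fin.Subset.Properties
  using (x∈⁅x⁆; x∈p∪q⁺; ∣⁅x⁆∣≡1; ∣⊥∣≡0; p⊂q⇒∣p∣<∣q∣; x∈⁅y⁆⇒x≡y; ∣⊤∣≡n; ∈⊤)
open import Relation.Binary.PropositionalEquality
  using (_≡_; _≢_; refl; trans; cong; cong₂; subst; ≢-sym; module ≡-Reasoning) renaming (sym to ≡-sym)

clash : ∀ {x : Bool} → x ≡ true → x ≡ false → ⊥
clash refl ()

module Adjacency (G : Graph) where

  adj-sym : ∀ {x y b} → adj G x y ≡ b → adj G y x ≡ b
  adj-sym {x} {y} e = trans (Graph.sym G y x) e

  adj⇒≢ : ∀ {x y} → adj G x y ≡ true → x ≢ y
  adj⇒≢ {x} e refl = clash e (irrefl G x)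

  separatedBy : ∀ {x y z} → adj G x z ≡ true → adj G y z ≡ false → x ≢ y
  separatedBy e₁ e₂ refl = clash e₁ e₂

-- Obstructions to interval models

-- The first vertex of the walk is not required to avoid z.
data Avoiding (G : Graph) (P : Fin (n G) → Set) (z : Fin (n G)) : Fin (n G) → Fin (n G) → Set where
  stop : ∀ {x} → Avoiding G P z x x
  step : ∀ {x y w} → P y → adj G x y ≡ true → adj G y z ≡ false → Avoiding G P z y w → Avoiding G P z x w

mapAvoiding : ∀ {G : Graph} {P Q : Fin (n G) → Set} {z x w} →
              (∀ {v} → P v → Q v) → Avoiding G P z x w → Avoiding G Q z x w
mapAvoiding h stop = stop
mapAvoiding h (step yP xy yz p) = step (h yP) xy yz (mapAvoiding h p)

module IntervalModel (G : Graph) (X : Subset (n G)) (lo hi : Fin (n G) → ℕ)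
  (lo≤hi : ∀ x → x ∈ X → lo x ≤ hi x)
  (model : ∀ x y → x ∈ X → y ∈ X → x ≢ y →
           ((adj G x y ≡ true → (lo x ≤ hi y × lo y ≤ hi x)) ×
            ((lo x ≤ hi y × lo y ≤ hi x) → adj G x y ≡ true))) where

  open Adjacency G

  intersect : ∀ {x y} → x ∈ X → y ∈ X → adj G x y ≡ true → lo x ≤ hi y × lo y ≤ hi x
  intersect xX yX e = proj₁ (model _ _ xX yX (adj⇒≢ e)) e

  nonadjacent : ∀ {x y} → x ∈ X → y ∈ X → x ≢ y → adj G x y ≡ false → hi x < lo y ⊎ hi y < lo x
  nonadjacent {x} {y} xX yX x≢y e with lo x ≤? hi y | lo y ≤? hi x
  ... | yes p | yes q = ⊥-elim (clash (proj₂ (model _ _ xX yX x≢y) (p , q)) e)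
  nonadjacent xX yX x≢y e | yes _ | no q = inj₁ (ℕ.≰⇒> q)
  nonadjacent xX yX x≢y e | no p  | _    = inj₂ (ℕ.≰⇒> p)

  cyclic : ∀ {a b c d} → a ≤ b → b < c → c ≤ d → d < a → ⊥
  cyclic p q r t = ℕ.<-irrefl refl (ℕ.≤-<-trans p (ℕ.<-trans (ℕ.<-≤-trans q r) t))

  -- No w ≢ z is needed: if w ≡ z, then v meets z while lying left of it.
  stepLeftOf : ∀ {v w z} → v ∈ X → w ∈ X → z ∈ X → adj G v w ≡ true → adj G w z ≡ false →
               hi v < lo z → hi w < lo z
  stepLeftOf {v} {w} {z} vX wX zX vw wz v<z with w ≟ z
  ... | yes refl = ⊥-elim (ℕ.<-irrefl refl (ℕ.≤-<-trans (proj₂ (intersect vX wX vw)) v<z))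
  ... | no w≢z with nonadjacent wX zX w≢z wz
  ...   | inj₁ w<z = w<z
  ...   | inj₂ z<w = ⊥-elim (cyclic (proj₂ (intersect vX wX vw)) v<z (lo≤hi z zX) z<w)

  stepRightOf : ∀ {v w z} → v ∈ X → w ∈ X → z ∈ X → adj G v w ≡ true → adj G w z ≡ false →
                hi z < lo v → hi z < lo w
  stepRightOf {v} {w} {z} vX wX zX vw wz z<v with w ≟ z
  ... | yes refl = ⊥-elim (ℕ.<-irrefl refl (ℕ.<-≤-trans z<v (proj₁ (intersect vX wX vw))))
  ... | no w≢z with nonadjacent wX zX w≢z wz
  ...   | inj₂ z<w = z<w
  ...   | inj₁ w<z = ⊥-elim (cyclic (proj₁ (intersect vX wX vw)) w<z (lo≤hi z zX) z<v)

  avoidsLeftOf : ∀ {z x w} → Avoiding G (_∈ X) z x w → z ∈ X → x ∈ X → hi x < lo z → hi w < lo z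
  avoidsLeftOf stop zX xX x<z = x<z
  avoidsLeftOf (step yX xy yz p) zX xX x<z = avoidsLeftOf p zX yX (stepLeftOf xX yX zX xy yz x<z)

  avoidsRightOf : ∀ {z x w} → Avoiding G (_∈ X) z x w → z ∈ X → x ∈ X → hi z < lo x → hi z < lo w
  avoidsRightOf stop zX xX z<x = z<x
  avoidsRightOf (step yX xy yz p) zX xX z<x = avoidsRightOf p zX yX (stepRightOf xX yX zX xy yz z<x)

module Obstructions (G : Graph) (X : Subset (n G)) where

  open Adjacency G

  asteroidal⇒¬interval :
    ∀ {a b c} → a ∈ X → b ∈ X → c ∈ X → a ≢ b → b ≢ c → a ≢ c →
    adj G a b ≡ false → adj G b c ≡ false → adj G a c ≡ false →
    Avoiding G (_∈ X) c a b → Avoiding G (_∈ X) b a c → Avoiding G (_∈ X) a b c →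
    ¬ IsIntervalOn G X
  asteroidal⇒¬interval {a} {b} {c} aX bX cX a≢b b≢c a≢c ab bc ac a⇝b a⇝c b⇝c (lo , hi , lo≤hi , model) =
    contradiction
    where
    open IntervalModel G X lo hi lo≤hi model

    blocked : ∀ {x y z} → x ∈ X → y ∈ X → z ∈ X → Avoiding G (_∈ X) y x z →
              ¬ ((hi x < lo y × hi y < lo z) ⊎ (hi y < lo x × hi z < lo y))
    blocked xX yX zX p (inj₁ (x<y , y<z)) = cyclic (lo≤hi _ yX) y<z (lo≤hi _ zX) (avoidsLeftOf p yX xX x<y)
    blocked xX yX zX p (inj₂ (y<x , z<y)) = cyclic (lo≤hi _ yX) (avoidsRightOf p yX xX y<x) (lo≤hi _ zX) z<y

    contradiction : ⊥
    contradiction with nonadjacent aX bX a≢b ab | nonadjacent bX cX b≢c bc | nonadjacent aX cX a≢c ac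
    ... | inj₁ a<b | inj₁ b<c | _        = blocked aX bX cX a⇝c (inj₁ (a<b , b<c))
    ... | inj₂ b<a | inj₂ c<b | _        = blocked aX bX cX a⇝c (inj₂ (b<a , c<b))
    ... | inj₁ a<b | inj₂ c<b | inj₁ a<c = blocked aX cX bX a⇝b (inj₁ (a<c , c<b))
    ... | inj₁ a<b | inj₂ c<b | inj₂ c<a = blocked bX aX cX b⇝c (inj₂ (a<b , c<a))
    ... | inj₂ b<a | inj₁ b<c | inj₁ a<c = blocked bX aX cX b⇝c (inj₁ (b<a , a<c))
    ... | inj₂ b<a | inj₁ b<c | inj₂ c<a = blocked aX cX bX a⇝b (inj₂ (c<a , b<c))

  hole₄⇒¬interval : ∀ {a b c d} → a ∈ X → b ∈ X → c ∈ X → d ∈ X → a ≢ c → b ≢ d →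
                    adj G a b ≡ true → adj G b c ≡ true → adj G c d ≡ true → adj G d a ≡ true →
                    adj G a c ≡ false → adj G b d ≡ false → ¬ IsIntervalOn G X
  hole₄⇒¬interval {a} {b} {c} {d} aX bX cX dX a≢c b≢d ab bc cd da ac bd (lo , hi , lo≤hi , model) =
    contradiction
    where
    open IntervalModel G X lo hi lo≤hi model

    -- two common neighbours of x and y both cover the gap between them
    bridgesMeet : ∀ {x y} → x ∈ X → y ∈ X → hi x < lo y →
                  adj G b x ≡ true → adj G b y ≡ true → adj G d x ≡ true → adj G d y ≡ true → ⊥
    bridgesMeet xX yX x<y bx by dx dy with trans (≡-sym bd) (proj₂ (model b d bX dX b≢d) (b≤d , d≤b))
      where
      b≤d = ℕ.≤-trans (proj₁ (intersect bX xX bx)) (ℕ.≤-trans (ℕ.<⇒≤ x<y) (proj₂ (intersect dX yX dy)))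
      d≤b = ℕ.≤-trans (proj₁ (intersect dX xX dx)) (ℕ.≤-trans (ℕ.<⇒≤ x<y) (proj₂ (intersect bX yX by)))
    ... | ()

    contradiction : ⊥
    contradiction with nonadjacent aX cX a≢c ac
    ... | inj₁ a<c = bridgesMeet aX cX a<c (adj-sym ab) bc da (adj-sym cd)
    ... | inj₂ c<a = bridgesMeet cX aX c<a bc (adj-sym ab) (adj-sym cd) da

  hole₅⇒¬interval : ∀ {a b c d e} → a ∈ X → b ∈ X → c ∈ X → d ∈ X → e ∈ X → a ≢ c →
                    adj G a b ≡ true → adj G b c ≡ true → adj G c d ≡ true → adj G d e ≡ true →
                    adj G e a ≡ true → adj G a c ≡ false → adj G e b ≡ false → adj G d b ≡ false →
                    ¬ IsIntervalOn G X
  hole₅⇒¬interval {a} {b} {c} {d} {e} aX bX cX dX eX a≢c ab bc cd de ea ac eb db (lo , hi , lo≤hi , model) =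
    contradiction
    where
    open IntervalModel G X lo hi lo≤hi model

    e≢b : e ≢ b
    e≢b = separatedBy (adj-sym de) (adj-sym db)

    contradiction : ⊥
    contradiction with nonadjacent aX cX a≢c ac | nonadjacent eX bX e≢b eb
    ... | inj₁ a<c | inj₁ e<b = cyclic (proj₁ (intersect cX dX cd)) (stepLeftOf eX dX bX (adj-sym de) db e<b)
                                       (proj₁ (intersect bX aX (adj-sym ab))) a<c
    ... | inj₁ a<c | inj₂ b<e = cyclic (proj₁ (intersect eX aX ea)) a<c (proj₂ (intersect bX cX bc)) b<e
    ... | inj₂ c<a | inj₁ e<b = cyclic (proj₂ (intersect eX aX ea)) e<b (proj₁ (intersect bX cX bc)) c<a
    ... | inj₂ c<a | inj₂ b<e = cyclic (proj₁ (intersect dX cX (adj-sym cd))) c<a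
                                       (proj₂ (intersect bX aX (adj-sym ab))) (stepRightOf eX dX bX (adj-sym de) db b<e)

-- Small subgraphs of a prereduced graph

¬¬-→ : ∀ {A B : Set} → (A → ¬ ¬ B) → ¬ ¬ (A → B)
¬¬-→ f k = k (λ a → ⊥-elim (f a (λ b → k (λ _ → b))))

¬¬-∀-Subset : ∀ {m} {P : Subset m → Set} → (∀ X → ¬ ¬ P X) → ¬ ¬ (∀ X → P X)
¬¬-∀-Subset {zero} h k = h [] (λ p → k (λ { [] → p }))
¬¬-∀-Subset {suc m} {P} h k =
  ¬¬-∀-Subset {P = λ X → P (true ∷ X)} (λ X → h (true ∷ X)) (λ Pt →
  ¬¬-∀-Subset {P = λ X → P (false ∷ X)} (λ X → h (false ∷ X)) (λ Pf →
  k (λ { (true ∷ X) → Pt X ; (false ∷ X) → Pf X })))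

-- IsIntervalOn is not decidable, so no minimal forbidden subset can be extracted; we only
-- refute non-intervality.
prereduced⇒¬¬interval : ∀ {G} → Prereduced G → ∀ X → ∣ X ∣ ≤ 10 → ¬ ¬ IsIntervalOn G X
prereduced⇒¬¬interval {G} pre X = below (suc ∣ X ∣) X ℕ.≤-refl
  where
  below : ∀ k X → ∣ X ∣ < k → ∣ X ∣ ≤ 10 → ¬ ¬ IsIntervalOn G X
  below (suc k) X (s≤s X≤k) X≤10 ¬interval =
    ¬¬-∀-Subset (λ Y → ¬¬-→ λ Y⊂X → below k Y (ℕ.<-≤-trans (p⊂q⇒∣p∣<∣q∣ Y⊂X) X≤k)
                                              (ℕ.≤-trans (ℕ.<⇒≤ (p⊂q⇒∣p∣<∣q∣ Y⊂X)) X≤10))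
      (λ subsetsInterval → pre X X≤10 (¬interval , subsetsInterval))

∣p∪q∣≤∣p∣+∣q∣ : ∀ {m} (p q : Subset m) → ∣ p ∪ q ∣ ≤ ∣ p ∣ + ∣ q ∣
∣p∪q∣≤∣p∣+∣q∣ [] [] = z≤n
∣p∪q∣≤∣p∣+∣q∣ (true ∷ p) (true ∷ q) =
  s≤s (ℕ.≤-trans (∣p∪q∣≤∣p∣+∣q∣ p q) (ℕ.+-monoʳ-≤ ∣ p ∣ (ℕ.n≤1+n _)))
∣p∪q∣≤∣p∣+∣q∣ (true ∷ p) (false ∷ q) = s≤s (∣p∪q∣≤∣p∣+∣q∣ p q)
∣p∪q∣≤∣p∣+∣q∣ (false ∷ p) (true ∷ q) =
  ℕ.≤-trans (s≤s (∣p∪q∣≤∣p∣+∣q∣ p q)) (ℕ.≤-reflexive (≡-sym (ℕ.+-suc _ _)))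
∣p∪q∣≤∣p∣+∣q∣ (false ∷ p) (false ∷ q) = ∣p∪q∣≤∣p∣+∣q∣ p q

window : ∀ {m} → List (Fin m) → Subset m
window = foldr (λ x X → ⁅ x ⁆ ∪ X) ∅

∣window∣≤length : ∀ {m} (L : List (Fin m)) → ∣ window L ∣ ≤ length L
∣window∣≤length {m} [] = ℕ.≤-reflexive (∣⊥∣≡0 m)
∣window∣≤length (x ∷ L) = ℕ.≤-trans (∣p∪q∣≤∣p∣+∣q∣ ⁅ x ⁆ (window L))
  (ℕ.≤-trans (ℕ.≤-reflexive (cong (_+ ∣ window L ∣) (∣⁅x⁆∣≡1 x))) (s≤s (∣window∣≤length L)))

∈window : ∀ {m} {x : Fin m} {L} → x ∈ᴸ L → x ∈ window L
∈window (here refl) = x∈p∪q⁺ (inj₁ (x∈⁅x⁆ _))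
∈window (there x∈L) = x∈p∪q⁺ (inj₂ (∈window x∈L))

-- A window is a list of at most ten vertices; its length bound is checked by evaluation.
module SmallWindows (G : Graph) (pre : Prereduced G) where

  open Obstructions G

  private
    V = Fin (n G)

    refute : (L : List V) → T (length L ≤ᵇ 10) → ¬ IsIntervalOn G (window L) → ⊥
    refute L fits ¬interval =
      prereduced⇒¬¬interval {G} pre (window L)
        (ℕ.≤-trans (∣window∣≤length L) (ℕ.≤ᵇ⇒≤ (length L) 10 fits)) ¬interval

  noAsteroidalTriple :
    (L : List V) {fits : T (length L ≤ᵇ 10)} → ∀ {a b c} → a ∈ᴸ L → b ∈ᴸ L → c ∈ᴸ L →
    a ≢ b → b ≢ c → a ≢ c → adj G a b ≡ false → adj G b c ≡ false → adj G a c ≡ false →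
    Avoiding G (_∈ᴸ L) c a b → Avoiding G (_∈ᴸ L) b a c → Avoiding G (_∈ᴸ L) a b c → ⊥
  noAsteroidalTriple L {fits} aL bL cL a≢b b≢c a≢c ab bc ac a⇝b a⇝c b⇝c =
    refute L fits (asteroidal⇒¬interval (window L) (∈window aL) (∈window bL) (∈window cL) a≢b b≢c a≢c ab bc ac
                     (mapAvoiding ∈window a⇝b) (mapAvoiding ∈window a⇝c) (mapAvoiding ∈window b⇝c))

  noHole₄ : (L : List V) {fits : T (length L ≤ᵇ 10)} → ∀ {a b c d} →
            a ∈ᴸ L → b ∈ᴸ L → c ∈ᴸ L → d ∈ᴸ L → a ≢ c → b ≢ d →
            adj G a b ≡ true → adj G b c ≡ true → adj G c d ≡ true → adj G d a ≡ true →
            adj G a c ≡ false → adj G b d ≡ false → ⊥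
  noHole₄ L {fits} aL bL cL dL a≢c b≢d ab bc cd da ac bd =
    refute L fits (hole₄⇒¬interval (window L) (∈window aL) (∈window bL) (∈window cL) (∈window dL)
                     a≢c b≢d ab bc cd da ac bd)

  noHole₅ : (L : List V) {fits : T (length L ≤ᵇ 10)} → ∀ {a b c d e} →
            a ∈ᴸ L → b ∈ᴸ L → c ∈ᴸ L → d ∈ᴸ L → e ∈ᴸ L → a ≢ c →
            adj G a b ≡ true → adj G b c ≡ true → adj G c d ≡ true → adj G d e ≡ true →
            adj G e a ≡ true → adj G a c ≡ false → adj G e b ≡ false → adj G d b ≡ false → ⊥
  noHole₅ L {fits} aL bL cL dL eL a≢c ab bc cd de ea ac eb db =
    refute L fits (hole₅⇒¬interval (window L) (∈window aL) (∈window bL) (∈window cL) (∈window dL) (∈window eL)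
                     a≢c ab bc cd de ea ac eb db)

pattern #0 = here refl
pattern #1 = there #0
pattern #2 = there #1
pattern #3 = there #2
pattern #4 = there #3
pattern #5 = there #4
pattern #6 = there #5
pattern #7 = there #6

-- The module argument

module ModuleArgument (G : Graph) (reduced : Reduced G) (s : Fin (n G))
  {Candidate Centre : Fin (n G) → Set} (candidate? : Decidable Candidate) (centre? : Decidable Centre)
  (s-candidate : Candidate s)
  (centre-complete : ∀ {c x} → Centre c → Candidate x → adj G c x ≡ true)
  (outsider-uniform : ∀ {y x z} → ¬ Candidate y → ¬ Centre y → Candidate x → Candidate z →
                      adj G x z ≡ true → adj G y x ≡ adj G y z)
  (nonEdge-candidate : ∀ {u w} → adj G s u ≡ true → adj G s w ≡ true → u ≢ w → adj G u w ≡ false → Candidate u)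
  {c₀ : Fin (n G)} (c₀-nonCandidate : ¬ Candidate c₀) where

  open Adjacency G

  LikeS : Fin (n G) → Set
  LikeS x = Candidate x × (∀ y → ¬ Candidate y → ¬ Centre y → adj G y x ≡ adj G y s)

  likeS? : Decidable LikeS
  likeS? x = candidate? x ×-dec
             all? (λ y → ¬? (candidate? y) →-dec (¬? (centre? y) →-dec (adj G y x Bool.≟ adj G y s)))

  M : Subset (n G)
  M = tabulate (λ x → ⌊ likeS? x ⌋)

  ∈M⇒likeS : ∀ {x} → x ∈ M → LikeS x
  ∈M⇒likeS {x} x∈M =
    toWitness {a? = likeS? x} (subst T (≡-sym (trans (≡-sym (lookup∘tabulate _ x)) ([]=⇒lookup x∈M))) tt)

  likeS⇒∈M : ∀ {x} → LikeS x → x ∈ M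
  likeS⇒∈M {x} p = lookup⇒[]= x M (trans (lookup∘tabulate _ x) (trans (isYes≗does (likeS? x)) (dec-true (likeS? x) p)))

  candidate⇒likeS : ∀ {x} → Candidate x → adj G x s ≡ true → LikeS x
  candidate⇒likeS x-cand xs = x-cand , λ y ¬cand ¬centre → outsider-uniform ¬cand ¬centre x-cand s-candidate xs

  M-module : IsModule G M
  M-module a b z a∈M b∈M z∉M with candidate? z | centre? z
  ... | yes z-cand | _ = trans (separate a∈M) (≡-sym (separate b∈M))
    where
    separate : ∀ {x} → x ∈ M → adj G x z ≡ false
    separate {x} x∈M with adj G x z in xz
    ... | false = refl
    ... | true  = ⊥-elim (z∉M (likeS⇒∈M (z-cand , λ y ¬cand ¬centre →
                    trans (outsider-uniform ¬cand ¬centre z-cand (proj₁ (∈M⇒likeS x∈M)) (adj-sym xz))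
                          (proj₂ (∈M⇒likeS x∈M) y ¬cand ¬centre))))
  ... | no ¬cand | yes z-centre =
    trans (adj-sym (centre-complete z-centre (proj₁ (∈M⇒likeS a∈M))))
          (≡-sym (adj-sym (centre-complete z-centre (proj₁ (∈M⇒likeS b∈M)))))
  ... | no ¬cand | no ¬centre =
    trans (adj-sym (proj₂ (∈M⇒likeS a∈M) z ¬cand ¬centre)) (≡-sym (adj-sym (proj₂ (∈M⇒likeS b∈M) z ¬cand ¬centre)))

  simplicial : Simplicial G s
  simplicial u w su sw u≢w with adj G u w in uw
  ... | true  = refl
  ... | false with proj₂ reduced M M-module (1<∣M∣ , ∣M∣<n) u w u∈M w∈M u≢w
    where
    u∈M = likeS⇒∈M (candidate⇒likeS (nonEdge-candidate su sw u≢w uw) (adj-sym su))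
    w∈M = likeS⇒∈M (candidate⇒likeS (nonEdge-candidate sw su (≢-sym u≢w) (adj-sym uw)) (adj-sym sw))

    1<∣M∣ : 1 < ∣ M ∣
    1<∣M∣ = ℕ.≤-<-trans (ℕ.≤-reflexive (≡-sym (∣⁅x⁆∣≡1 u)))
              (p⊂q⇒∣p∣<∣q∣ ((λ x∈⁅u⁆ → subst (_∈ M) (≡-sym (x∈⁅y⁆⇒x≡y u x∈⁅u⁆)) u∈M) ,
                            w , w∈M , λ w∈⁅u⁆ → u≢w (≡-sym (x∈⁅y⁆⇒x≡y u w∈⁅u⁆))))

    ∣M∣<n : ∣ M ∣ < n G
    ∣M∣<n = ℕ.<-≤-trans
      (p⊂q⇒∣p∣<∣q∣ ((λ _ → ∈⊤) , c₀ , ∈⊤ , λ c₀∈M → c₀-nonCandidate (proj₁ (∈M⇒likeS c₀∈M))))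
      (ℕ.≤-reflexive (∣⊤∣≡n (n G)))
  ... | uw-true = ⊥-elim (clash uw-true uw)

-- The base of an AW

boolean-ivt : (P : ℕ → Bool) {a b : ℕ} → a ≤ b → P a ≢ P b →
              Σ ℕ λ j → a ≤ j × j < b × P j ≡ P a × P (suc j) ≡ P b
boolean-ivt P {a} {zero} z≤n Pa≢Pb = ⊥-elim (Pa≢Pb refl)
boolean-ivt P {a} {suc b} a≤sb Pa≢Pb with a ℕ.≟ suc b
... | yes refl = ⊥-elim (Pa≢Pb refl)
... | no a≢sb with P b Bool.≟ P a
...   | yes Pb≡Pa = b , a≤b , ℕ.≤-refl , Pb≡Pa , refl
  where a≤b = ℕ.≤-pred (ℕ.≤∧≢⇒< a≤sb a≢sb)
...   | no Pb≢Pa with boolean-ivt P (ℕ.≤-pred (ℕ.≤∧≢⇒< a≤sb a≢sb)) (≢-sym Pb≢Pa)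
...     | j , a≤j , j<b , Pj≡Pa , Psj≡Pb =
  j , a≤j , ℕ.m≤n⇒m≤1+n j<b , Pj≡Pa , trans Psj≡Pb (trans (Bool.¬-not Pb≢Pa) (≡-sym (Bool.¬-not (≢-sym Pa≢Pb))))

≢⇒≡ᵇ-false : ∀ {m n} → m ≢ n → (m ≡ᵇ n) ≡ false
≢⇒≡ᵇ-false {m} {n} m≢n = Bool.¬-not (λ e → m≢n (ℕ.≡ᵇ⇒≡ m n (Equivalence.from Bool.T-≡ e)))

pathAdj-next : ∀ i → pathAdj i (suc i) ≡ true
pathAdj-next i = cong (_∨ (i ≡ᵇ suc (suc i))) (Equivalence.to Bool.T-≡ (ℕ.≡⇒≡ᵇ i i refl))

pathAdj-far : ∀ {i j} → suc (suc i) ≤ j → pathAdj i j ≡ false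
pathAdj-far {i} {j} i+2≤j = cong₂ _∨_ (≢⇒≡ᵇ-false (λ e → ℕ.<-irrefl (≡-sym e) i+2≤j))
                                      (≢⇒≡ᵇ-false (ℕ.<⇒≢ (ℕ.m≤n⇒m≤1+n (ℕ.≤-trans (ℕ.n≤1+n _) i+2≤j))))

clamp : (m i : ℕ) → Fin (suc m)
clamp m       zero    = Fin.zero
clamp zero    (suc i) = Fin.zero
clamp (suc m) (suc i) = Fin.suc (clamp m i)

toℕ-clamp : ∀ {m i} → i ≤ m → toℕ (clamp m i) ≡ i
toℕ-clamp {m}     {zero}  _         = refl
toℕ-clamp {suc m} {suc i} (s≤s i≤m) = cong suc (toℕ-clamp i≤m)

clamp-toℕ : ∀ m (k : Fin (suc m)) → clamp m (toℕ k) ≡ k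
clamp-toℕ m       Fin.zero    = refl
clamp-toℕ (suc m) (Fin.suc k) = cong Fin.suc (clamp-toℕ m k)

module BasePath (G : Graph) (d : ℕ) (2≤d : 2 ≤ d) (b : Fin (suc (suc d)) → Fin (n G))
  (b-injective : Injective _≡_ _≡_ b)
  (b-path : ∀ i j → adj G (b i) (b j) ≡ pathAdj (toℕ i) (toℕ j)) where

  open Adjacency G

  V = Fin (n G)

  BaseFree : V → Set
  BaseFree x = ∀ k → adj G x (b k) ≡ false

  baseFree? : Decidable BaseFree
  baseFree? x = all? (λ k → adj G x (b k) Bool.≟ false)

  -- B is opaque so that its index can be inferred; B (suc d + k) is junk (it is B (suc d)),
  -- and every lemma below bounds its indices.
  opaque
    B : ℕ → V
    B i = b (clamp (suc d) i)

    B-path : ∀ {i j} → i ≤ suc d → j ≤ suc d → adj G (B i) (B j) ≡ pathAdj i j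
    B-path i≤sd j≤sd = trans (b-path _ _) (cong₂ pathAdj (toℕ-clamp i≤sd) (toℕ-clamp j≤sd))

    B-injective : ∀ {i j} → i < j → j ≤ suc d → B i ≢ B j
    B-injective {i} {j} i<j j≤sd Bi≡Bj = ℕ.<⇒≢ i<j (begin
      i                     ≡⟨ toℕ-clamp (ℕ.≤-trans (ℕ.<⇒≤ i<j) j≤sd) ⟨
      toℕ (clamp (suc d) i) ≡⟨ cong toℕ (b-injective Bi≡Bj) ⟩
      toℕ (clamp (suc d) j) ≡⟨ toℕ-clamp j≤sd ⟩
      j                     ∎)
      where open ≡-Reasoning

    baseFree-B : ∀ {x} → BaseFree x → ∀ i → adj G x (B i) ≡ false
    baseFree-B free i = free _

    B-adj : ∀ {x} (f : ℕ → Bool) → (∀ k → adj G x (b k) ≡ f (toℕ k)) → ∀ {i} → i ≤ suc d → adj G x (B i) ≡ f i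
    B-adj f x-b i≤sd = trans (x-b _) (cong f (toℕ-clamp i≤sd))

    B-inRange : ∀ i → Σ ℕ λ i′ → i′ ≤ suc d × B i ≡ B i′
    B-inRange i = toℕ (clamp (suc d) i) , toℕ≤pred[n] (clamp (suc d) i) , cong b (≡-sym (clamp-toℕ (suc d) _))

    baseNeighbour : ∀ {x} → ¬ BaseFree x → Σ ℕ λ i → i ≤ suc d × adj G x (B i) ≡ true
    baseNeighbour {x} ¬free with ¬∀⟶∃¬ _ _ (λ k → adj G x (b k) Bool.≟ false) ¬free
    ... | k , xk = toℕ k , toℕ≤pred[n] k ,
                   subst (λ k′ → adj G x (b k′) ≡ true) (≡-sym (clamp-toℕ (suc d) k)) (Bool.¬-not xk)

  B-next : ∀ {i} → i ≤ d → adj G (B i) (B (suc i)) ≡ true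
  B-next {i} i≤d = trans (B-path (ℕ.m≤n⇒m≤1+n i≤d) (s≤s i≤d)) (pathAdj-next i)

  B-prev : ∀ {i} → i ≤ d → adj G (B (suc i)) (B i) ≡ true
  B-prev i≤d = adj-sym (B-next i≤d)

  B-far : ∀ {i j} → suc (suc i) ≤ j → j ≤ suc d → adj G (B i) (B j) ≡ false
  B-far i+2≤j j≤sd = trans (B-path (ℕ.≤-trans (ℕ.m≤n+m _ 2) (ℕ.≤-trans i+2≤j j≤sd)) j≤sd) (pathAdj-far i+2≤j)

  B-far′ : ∀ {i j} → suc (suc i) ≤ j → j ≤ suc d → adj G (B j) (B i) ≡ false
  B-far′ i+2≤j j≤sd = adj-sym (B-far i+2≤j j≤sd)

  B-hasNeighbour : ∀ {i} → i ≤ suc d → Σ ℕ λ j → adj G (B i) (B j) ≡ true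
  B-hasNeighbour {i} i≤sd with i ℕ.≟ suc d
  ... | yes refl = d , B-prev ℕ.≤-refl
  ... | no i≢sd  = suc i , B-next (ℕ.≤-pred (ℕ.≤∧≢⇒< i≤sd i≢sd))

  baseFree⇒≢B : ∀ {x} → BaseFree x → ∀ {i} → x ≢ B i
  baseFree⇒≢B free {i} with B-inRange i
  ... | i′ , i′≤sd , Bi≡Bi′ with B-hasNeighbour i′≤sd
  ...   | j , e = λ x≡Bi → separatedBy e (baseFree-B free j) (trans (≡-sym Bi≡Bi′) (≡-sym x≡Bi))

  1≤d : 1 ≤ d
  1≤d = ℕ.≤-trans (s≤s z≤n) 2≤d

  -- cL misses the left end B 0 and cR the right end B (suc d) of the base: both are c in
  -- a †-AW, while cL = c₂ and cR = c₁ in a ‡-AW.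
  module Centres (cL cR : V)
    (cL-B₀ : adj G cL (B 0) ≡ false) (cL-B : ∀ {i} → 1 ≤ i → i ≤ d → adj G cL (B i) ≡ true)
    (cR-Bₑ : adj G cR (B (suc d)) ≡ false) (cR-B : ∀ {i} → 1 ≤ i → i ≤ d → adj G cR (B i) ≡ true) where

    cL⇝B : ∀ {P : V → Set} {i} → P (B d) → P (B i) → 2 ≤ i → i ≤ suc d → Avoiding G P (B 0) cL (B i)
    cL⇝B {i = i} Bd∈P Bi∈P 2≤i i≤sd with i ℕ.≟ suc d
    ... | yes refl = step Bd∈P (cL-B 1≤d ℕ.≤-refl) (B-far′ 2≤d (ℕ.n≤1+n d))
                       (step Bi∈P (B-next ℕ.≤-refl) (B-far′ (s≤s 1≤d) ℕ.≤-refl) stop)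
    ... | no i≢sd  =
      step Bi∈P (cL-B (ℕ.≤-trans (s≤s z≤n) 2≤i) (ℕ.≤-pred (ℕ.≤∧≢⇒< i≤sd i≢sd))) (B-far′ 2≤i i≤sd) stop

    cR⇝B : ∀ {P : V → Set} {i} → P (B 1) → P (B i) → i < d → Avoiding G P (B (suc d)) cR (B i)
    cR⇝B {i = zero}  B₁∈P B₀∈P _ = step B₁∈P (cR-B ℕ.≤-refl 1≤d) (B-far (s≤s 2≤d) ℕ.≤-refl)
                                     (step B₀∈P (B-prev z≤n) (B-far (s≤s 1≤d) ℕ.≤-refl) stop)
    cR⇝B {i = suc i} _ Bi∈P si<d = step Bi∈P (cR-B (s≤s z≤n) (ℕ.<⇒≤ si<d)) (B-far (s≤s si<d) ℕ.≤-refl) stop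

    -- y sees m₁ but not its neighbour m₂; wherever the runs of y's base neighbours lie,
    -- they close an asteroidal triple or a hole on at most eight vertices.
    module PartialNeighbour (pre : Prereduced G) (y m₁ m₂ : V)
      (y-cL : adj G y cL ≡ true) (y-cR : adj G y cR ≡ true)
      (m₁-cL : adj G m₁ cL ≡ true) (m₁-cR : adj G m₁ cR ≡ true)
      (m₂-cL : adj G m₂ cL ≡ true) (m₂-cR : adj G m₂ cR ≡ true)
      (y-m₁ : adj G y m₁ ≡ true) (y-m₂ : adj G y m₂ ≡ false) (m₁-m₂ : adj G m₁ m₂ ≡ true)
      (m₁-free : BaseFree m₁) (m₂-avoids : ∀ {i} → adj G y (B i) ≡ true → adj G m₂ (B i) ≡ false)
      {k : ℕ} (k≤sd : k ≤ suc d) (y-Bk : adj G y (B k) ≡ true) where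

      open SmallWindows G pre

      P : ℕ → Bool
      P i = adj G y (B i)

      B-m₁ : ∀ {i} → adj G (B i) m₁ ≡ false
      B-m₁ = adj-sym (baseFree-B m₁-free _)

      m₁-B : ∀ {i} → adj G m₁ (B i) ≡ false
      m₁-B = baseFree-B m₁-free _

      y≢B : ∀ {i} → y ≢ B i
      y≢B = separatedBy y-m₁ B-m₁

      m₂≢B : ∀ {i} → m₂ ≢ B i
      m₂≢B = separatedBy (adj-sym m₁-m₂) B-m₁

      m₁≢B : ∀ {i} → m₁ ≢ B i
      m₁≢B = baseFree⇒≢B m₁-free

      cL≢B : ∀ {i} → cL ≢ B i
      cL≢B = separatedBy (adj-sym m₁-cL) B-m₁

      cR≢B : ∀ {i} → cR ≢ B i
      cR≢B = separatedBy (adj-sym m₁-cR) B-m₁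

      hole₅ˡ : ∀ {i} → i ≤ d → P i ≡ false → P (suc i) ≡ true → adj G m₂ (B i) ≡ true → ⊥
      hole₅ˡ i≤d ¬yBi yBsi m₂Bi =
        noHole₅ (y ∷ B _ ∷ B _ ∷ m₂ ∷ m₁ ∷ []) #0 #1 #2 #3 #4 y≢B
          yBsi (B-prev i≤d) (adj-sym m₂Bi) (adj-sym m₁-m₂) (adj-sym y-m₁) ¬yBi m₁-B (m₂-avoids yBsi)

      hole₅ʳ : ∀ {j} → j ≤ d → P j ≡ true → P (suc j) ≡ false → adj G m₂ (B (suc j)) ≡ true → ⊥
      hole₅ʳ j≤d yBj ¬yBsj m₂Bsj =
        noHole₅ (y ∷ B _ ∷ B _ ∷ m₂ ∷ m₁ ∷ []) #0 #1 #2 #3 #4 y≢B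
          yBj (B-next j≤d) (adj-sym m₂Bsj) (adj-sym m₁-m₂) (adj-sym y-m₁) ¬yBsj m₁-B (m₂-avoids yBj)

      bothEnds : P 0 ≡ true → P (suc d) ≡ true → ⊥
      bothEnds yB₀ yBₑ =
        noAsteroidalTriple (m₂ ∷ cR ∷ B 1 ∷ B 0 ∷ cL ∷ B d ∷ B (suc d) ∷ y ∷ []) #0 #3 #6
          m₂≢B (B-injective (s≤s z≤n) ℕ.≤-refl) m₂≢B
          (m₂-avoids yB₀) (B-far (s≤s 1≤d) ℕ.≤-refl) (m₂-avoids yBₑ)
          (step #1 m₂-cR cR-Bₑ (cR⇝B #2 #3 1≤d))
          (step #4 m₂-cL cL-B₀ (cL⇝B #5 #6 (s≤s 1≤d) ℕ.≤-refl))
          (step #7 (adj-sym yB₀) y-m₂ (step #6 yBₑ (adj-sym (m₂-avoids yBₑ)) stop))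

      leftEnd : ∀ {j} → j ≤ d → P 0 ≡ true → P j ≡ true → P (suc j) ≡ false → ⊥
      leftEnd {zero} _ yB₀ _ ¬yB₁ =
        noHole₄ (y ∷ B 0 ∷ B 1 ∷ cL ∷ []) #0 #1 #2 #3 y≢B (≢-sym cL≢B)
          yB₀ (B-next z≤n) (adj-sym (cL-B ℕ.≤-refl 1≤d)) (adj-sym y-cL) ¬yB₁ (adj-sym cL-B₀)
      leftEnd {suc j} sj≤d yB₀ yBsj ¬yBssj with adj G m₂ (B (suc (suc j))) in m₂Bssj
      ... | true  = hole₅ʳ sj≤d yBsj ¬yBssj m₂Bssj
      ... | false =
        noAsteroidalTriple (m₂ ∷ m₁ ∷ y ∷ B 0 ∷ B (suc j) ∷ B (suc (suc j)) ∷ cL ∷ B d ∷ []) #0 #3 #5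
          m₂≢B (B-injective (s≤s z≤n) ssj≤sd) m₂≢B
          (m₂-avoids yB₀) (B-far (s≤s (s≤s z≤n)) ssj≤sd) m₂Bssj
          (step #1 (adj-sym m₁-m₂) m₁-B (step #2 (adj-sym y-m₁) ¬yBssj (step #3 yB₀ (B-far (s≤s (s≤s z≤n)) ssj≤sd) stop)))
          (step #6 m₂-cL cL-B₀ (cL⇝B #7 #5 (s≤s (s≤s z≤n)) ssj≤sd))
          (step #2 (adj-sym yB₀) y-m₂ (step #4 yBsj (adj-sym (m₂-avoids yBsj)) (step #5 (B-next sj≤d) (adj-sym m₂Bssj) stop)))
        where ssj≤sd = s≤s sj≤d

      rightEnd : ∀ {i} → i ≤ d → P (suc d) ≡ true → P i ≡ false → P (suc i) ≡ true → ⊥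
      rightEnd {i} i≤d yBₑ ¬yBi yBsi with i ℕ.≟ d
      ... | yes refl =
        noHole₄ (y ∷ B (suc d) ∷ B d ∷ cR ∷ []) #0 #1 #2 #3 y≢B (≢-sym cR≢B)
          yBₑ (B-prev ℕ.≤-refl) (adj-sym (cR-B 1≤d ℕ.≤-refl)) (adj-sym y-cR) ¬yBi (adj-sym cR-Bₑ)
      ... | no i≢d with adj G m₂ (B i) in m₂Bi
      ...   | true  = hole₅ˡ i≤d ¬yBi yBsi m₂Bi
      ...   | false =
        noAsteroidalTriple (m₂ ∷ m₁ ∷ y ∷ B (suc d) ∷ B (suc i) ∷ B i ∷ cR ∷ B 1 ∷ []) #0 #3 #5
          m₂≢B (≢-sym (B-injective (s≤s i≤d) ℕ.≤-refl)) m₂≢B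
          (m₂-avoids yBₑ) (B-far′ (s≤s i<d) ℕ.≤-refl) m₂Bi
          (step #1 (adj-sym m₁-m₂) m₁-B (step #2 (adj-sym y-m₁) ¬yBi (step #3 yBₑ (B-far′ (s≤s i<d) ℕ.≤-refl) stop)))
          (step #6 m₂-cR cR-Bₑ (cR⇝B #7 #5 i<d))
          (step #2 (adj-sym yBₑ) y-m₂ (step #4 yBsi (adj-sym (m₂-avoids yBsi)) (step #5 (B-prev i≤d) (adj-sym m₂Bi) stop)))
        where i<d = ℕ.≤∧≢⇒< i≤d i≢d

      longRun : ∀ {i j} → suc (suc i) ≤ j → j ≤ d →
                P i ≡ false → P (suc i) ≡ true → P j ≡ true → P (suc j) ≡ false → ⊥
      longRun {i} {j} i+2≤j j≤d ¬yBi yBsi yBj ¬yBsj with adj G m₂ (B i) in m₂Bi | adj G m₂ (B (suc j)) in m₂Bsj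
      ... | true  | _     = hole₅ˡ (ℕ.≤-trans (ℕ.m≤n+m i 2) (ℕ.≤-trans i+2≤j j≤d)) ¬yBi yBsi m₂Bi
      ... | false | true  = hole₅ʳ j≤d yBj ¬yBsj m₂Bsj
      ... | false | false =
        noAsteroidalTriple (m₂ ∷ m₁ ∷ y ∷ B i ∷ B (suc i) ∷ B j ∷ B (suc j) ∷ []) #0 #3 #6
          m₂≢B (B-injective (ℕ.≤-trans (ℕ.n≤1+n _) i+2≤sj) sj≤sd) m₂≢B m₂Bi (B-far i+2≤sj sj≤sd) m₂Bsj
          (step #1 (adj-sym m₁-m₂) m₁-B (step #2 (adj-sym y-m₁) ¬yBsj
            (step #4 yBsi (B-far (s≤s i+2≤j) sj≤sd) (step #3 (B-prev i≤d) (B-far i+2≤sj sj≤sd) stop))))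
          (step #1 (adj-sym m₁-m₂) m₁-B (step #2 (adj-sym y-m₁) ¬yBi
            (step #5 yBj (B-far′ i+2≤j j≤sd) (step #6 (B-next j≤d) (B-far′ i+2≤sj sj≤sd) stop))))
          (step #4 (B-next i≤d) (adj-sym (m₂-avoids yBsi)) (step #2 (adj-sym yBsi) y-m₂
            (step #5 yBj (adj-sym (m₂-avoids yBj)) (step #6 (B-next j≤d) (adj-sym m₂Bsj) stop))))
        where
        sj≤sd = s≤s j≤d
        j≤sd  = ℕ.m≤n⇒m≤1+n j≤d
        i+2≤sj = ℕ.m≤n⇒m≤1+n i+2≤j
        i≤d = ℕ.≤-trans (ℕ.m≤n+m i 2) (ℕ.≤-trans i+2≤j j≤d)

      isolated : ∀ {i} → suc i ≤ d → P i ≡ false → P (suc i) ≡ true → P (suc (suc i)) ≡ false → ⊥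
      isolated {zero} _ ¬yB₀ yB₁ ¬yB₂ with P 3 in yB₃
      ... | true  =
        noHole₄ (y ∷ B 1 ∷ B 2 ∷ B 3 ∷ []) #0 #1 #2 #3 y≢B (B-injective (s≤s (s≤s z≤n)) 3≤sd)
          yB₁ (B-next 1≤d) (B-next 2≤d) (adj-sym yB₃) ¬yB₂ (B-far ℕ.≤-refl 3≤sd)
        where 3≤sd = s≤s 2≤d
      ... | false =
        noAsteroidalTriple (B 0 ∷ B 1 ∷ B 2 ∷ B 3 ∷ y ∷ m₁ ∷ cL ∷ B d ∷ []) #0 #5 #3
          (≢-sym m₁≢B) m₁≢B (B-injective (s≤s z≤n) 3≤sd) B-m₁ m₁-B (B-far (s≤s (s≤s z≤n)) 3≤sd)
          (step #1 (B-next z≤n) (B-far ℕ.≤-refl 3≤sd) (step #4 (adj-sym yB₁) yB₃ (step #5 y-m₁ m₁-B stop)))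
          (step #1 (B-next z≤n) B-m₁ (step #2 (B-next 1≤d) B-m₁ (step #3 (B-next 2≤d) B-m₁ stop)))
          (step #6 m₁-cL cL-B₀ (cL⇝B #7 #3 (s≤s (s≤s z≤n)) 3≤sd))
        where 3≤sd = s≤s 2≤d
      isolated {suc i} ssi≤d ¬yBsi yBssi ¬yBsssi with P i in yBi
      ... | true =
        noHole₄ (y ∷ B (suc (suc i)) ∷ B (suc i) ∷ B i ∷ []) #0 #1 #2 #3 y≢B
          (≢-sym (B-injective (ℕ.m≤n+m (suc i) 1) (ℕ.m≤n⇒m≤1+n ssi≤d)))
          yBssi (B-prev si≤d) (B-prev i≤d) (adj-sym yBi) ¬yBsi (B-far′ ℕ.≤-refl (ℕ.m≤n⇒m≤1+n ssi≤d))
        where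
        si≤d = ℕ.≤-trans (ℕ.n≤1+n _) ssi≤d
        i≤d  = ℕ.≤-trans (ℕ.n≤1+n _) si≤d
      ... | false with suc (suc i) ℕ.≟ d
      ...   | yes ssi≡d =
        noAsteroidalTriple L #0 #5 #3
          (≢-sym m₁≢B) m₁≢B (≢-sym (B-injective (ℕ.m≤n+m _ 2) sssi≤sd))
          B-m₁ m₁-B (B-far′ (ℕ.m≤n+m _ 1) sssi≤sd)
          (step #1 (B-prev ssi≤d) (B-far′ ℕ.≤-refl ssi≤sd) (step #4 (adj-sym yBssi) yBi (step #5 y-m₁ m₁-B stop)))
          (step #1 (B-prev ssi≤d) B-m₁ (step #2 (B-prev si≤d) B-m₁ (step #3 (B-prev i≤d) B-m₁ stop)))
          (subst (λ t → Avoiding G (_∈ᴸ L) (B (suc t)) m₁ (B i)) (≡-sym ssi≡d) (step #6 m₁-cR cR-Bₑ (cR⇝B #7 #3 si≤d)))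
        where
        L = B (suc (suc (suc i))) ∷ B (suc (suc i)) ∷ B (suc i) ∷ B i ∷ y ∷ m₁ ∷ cR ∷ B 1 ∷ []
        sssi≤sd = s≤s ssi≤d
        ssi≤sd  = ℕ.m≤n⇒m≤1+n ssi≤d
        si≤d    = ℕ.≤-trans (ℕ.n≤1+n _) ssi≤d
        i≤d     = ℕ.≤-trans (ℕ.n≤1+n _) si≤d
      ...   | no ssi≢d with P (suc (suc (suc (suc i)))) in yBssssi
      ...     | true =
        noHole₄ (y ∷ B (suc (suc i)) ∷ B (suc (suc (suc i))) ∷ B (suc (suc (suc (suc i)))) ∷ []) #0 #1 #2 #3 y≢B
          (B-injective (ℕ.m≤n+m _ 1) ssssi≤sd)
          yBssi (B-next ssi≤d) (B-next sssi≤d) (adj-sym yBssssi) ¬yBsssi (B-far ℕ.≤-refl ssssi≤sd)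
        where
        sssi≤d   = ℕ.≤∧≢⇒< ssi≤d ssi≢d
        ssssi≤sd = s≤s sssi≤d
      ...     | false =
        noAsteroidalTriple
          (m₁ ∷ y ∷ B i ∷ B (suc i) ∷ B (suc (suc i)) ∷ B (suc (suc (suc i))) ∷ B (suc (suc (suc (suc i)))) ∷ [])
          #0 #2 #6
          m₁≢B (B-injective (ℕ.m≤n+m _ 3) ssssi≤sd) m₁≢B m₁-B (B-far (ℕ.m≤n+m _ 2) ssssi≤sd) m₁-B
          (step #1 (adj-sym y-m₁) yBssssi (step #4 yBssi (B-far ℕ.≤-refl ssssi≤sd)
            (step #3 (B-prev si≤d) (B-far (ℕ.n≤1+n _) ssssi≤sd) (step #2 (B-prev i≤d) (B-far (ℕ.m≤n+m _ 2) ssssi≤sd) stop))))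
          (step #1 (adj-sym y-m₁) yBi (step #4 yBssi (B-far′ ℕ.≤-refl ssi≤sd)
            (step #5 (B-next ssi≤d) (B-far′ (ℕ.n≤1+n _) sssi≤sd)
              (step #6 (B-next sssi≤d) (B-far′ (ℕ.m≤n+m _ 2) ssssi≤sd) stop))))
          (step #3 (B-next i≤d) B-m₁ (step #4 (B-next si≤d) B-m₁
            (step #5 (B-next ssi≤d) B-m₁ (step #6 (B-next sssi≤d) B-m₁ stop))))
        where
        sssi≤d   = ℕ.≤∧≢⇒< ssi≤d ssi≢d
        ssssi≤sd = s≤s sssi≤d
        sssi≤sd  = ℕ.m≤n⇒m≤1+n sssi≤d
        ssi≤sd   = ℕ.m≤n⇒m≤1+n ssi≤d
        si≤d     = ℕ.≤-trans (ℕ.n≤1+n _) ssi≤d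
        i≤d      = ℕ.≤-trans (ℕ.n≤1+n _) si≤d

      interior : ∀ {i j} → suc i ≤ j → j ≤ d →
                 P i ≡ false → P (suc i) ≡ true → P j ≡ true → P (suc j) ≡ false → ⊥
      interior {i} {j} si≤j j≤d ¬yBi yBsi yBj ¬yBsj with suc i ℕ.≟ j
      ... | yes refl = isolated j≤d ¬yBi yBsi ¬yBsj
      ... | no si≢j  = longRun (ℕ.≤∧≢⇒< si≤j si≢j) j≤d ¬yBi yBsi yBj ¬yBsj

      differ : ∀ {a b} → P a ≡ true → P b ≡ false → P a ≢ P b
      differ yBa ¬yBb e = clash (trans (≡-sym e) yBa) ¬yBb

      contradiction : ⊥
      contradiction with P 0 in yB₀ | P (suc d) in yBₑ
      ... | true  | true  = bothEnds yB₀ yBₑ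
      ... | true  | false with boolean-ivt P z≤n (differ yB₀ yBₑ)
      ...   | j , _ , j<sd , yBj , ¬yBsj = leftEnd (ℕ.≤-pred j<sd) yB₀ (trans yBj yB₀) (trans ¬yBsj yBₑ)
      contradiction | false | true with boolean-ivt P z≤n (≢-sym (differ yBₑ yB₀))
      ...   | i , _ , i<sd , ¬yBi , yBsi = rightEnd (ℕ.≤-pred i<sd) yBₑ (trans ¬yBi yB₀) (trans yBsi yBₑ)
      contradiction | false | false with boolean-ivt P z≤n (≢-sym (differ y-Bk yB₀))
                                       | boolean-ivt P k≤sd (differ y-Bk yBₑ)
      ...   | i , _ , i<k , ¬yBi , yBsi | j , k≤j , j<sd , yBj , ¬yBsj =
        interior (ℕ.≤-trans i<k k≤j) (ℕ.≤-pred j<sd) (trans ¬yBi yB₀) (trans yBsi y-Bk) (trans yBj y-Bk) (trans ¬yBsj yBₑ)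

    module ShallowTerminal (reduced : Reduced G) (s : V)
      (s-cL : adj G s cL ≡ true) (s-cR : adj G s cR ≡ true) (s-free : BaseFree s)
      (cL-cR : cL ≡ cR ⊎ adj G cL cR ≡ true)
      (seesBothCentres : ∀ {y m} → adj G cL m ≡ true → adj G cR m ≡ true → BaseFree m → adj G y m ≡ true →
                         y ≢ cL → y ≢ cR → adj G y cL ≡ true × adj G y cR ≡ true) where

      Candidate : V → Set
      Candidate x = adj G cL x ≡ true × adj G cR x ≡ true × BaseFree x

      candidate? : Decidable Candidate
      candidate? x = (adj G cL x Bool.≟ true) ×-dec (adj G cR x Bool.≟ true) ×-dec baseFree? x

      Centre : V → Set
      Centre x = x ≡ cL ⊎ x ≡ cR

      centre? : Decidable Centre
      centre? x = (x ≟ cL) ⊎-dec (x ≟ cR)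

      centre-complete : ∀ {c x} → Centre c → Candidate x → adj G c x ≡ true
      centre-complete (inj₁ refl) (cLx , _ , _) = cLx
      centre-complete (inj₂ refl) (_ , cRx , _) = cRx

      centres-adjacent : ∀ {c c′} → Centre c → Centre c′ → c ≢ c′ → adj G c c′ ≡ true
      centres-adjacent (inj₁ refl) (inj₁ refl) c≢c′ = ⊥-elim (c≢c′ refl)
      centres-adjacent (inj₂ refl) (inj₂ refl) c≢c′ = ⊥-elim (c≢c′ refl)
      centres-adjacent (inj₁ refl) (inj₂ refl) c≢c′ = [ ⊥-elim ∘ c≢c′ , id ]′ cL-cR
      centres-adjacent (inj₂ refl) (inj₁ refl) c≢c′ = [ ⊥-elim ∘ c≢c′ ∘ ≡-sym , adj-sym ]′ cL-cR

      adjacent-centres : ∀ {y m} → Candidate m → adj G y m ≡ true → ¬ Centre y → ∀ {c} → Centre c → adj G y c ≡ true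
      adjacent-centres (cLm , cRm , m-free) ym ¬centre (inj₁ refl) =
        proj₁ (seesBothCentres cLm cRm m-free ym (¬centre ∘ inj₁) (¬centre ∘ inj₂))
      adjacent-centres (cLm , cRm , m-free) ym ¬centre (inj₂ refl) =
        proj₂ (seesBothCentres cLm cRm m-free ym (¬centre ∘ inj₁) (¬centre ∘ inj₂))

      s-candidate : Candidate s
      s-candidate = adj-sym s-cL , adj-sym s-cR , s-free

      outsider-baseNeighbour : ∀ {y m} → Candidate m → adj G y m ≡ true → ¬ Centre y →
                              ¬ Candidate y → Σ ℕ λ k → k ≤ suc d × adj G y (B k) ≡ true
      outsider-baseNeighbour m-cand ym ¬centre ¬cand with baseFree? _
      ... | yes y-free = ⊥-elim (¬cand (adj-sym (adjacent-centres m-cand ym ¬centre (inj₁ refl)) ,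
                                        adj-sym (adjacent-centres m-cand ym ¬centre (inj₂ refl)) , y-free))
      ... | no ¬free = baseNeighbour ¬free

      seesOneEnd : ∀ {y m₁ m₂} → ¬ Candidate y → ¬ Centre y → Candidate m₁ → Candidate m₂ →
                   adj G m₁ m₂ ≡ true → adj G y m₁ ≡ true → adj G y m₂ ≡ false → ⊥
      seesOneEnd {y} {m₁} {m₂} ¬cand ¬centre m₁-cand@(cLm₁ , cRm₁ , m₁-free) (cLm₂ , cRm₂ , m₂-free) m₁m₂ ym₁ ym₂
        with outsider-baseNeighbour m₁-cand ym₁ ¬centre ¬cand
      ... | k , k≤sd , y-Bk =
        PartialNeighbour.contradiction (proj₁ reduced) y m₁ m₂
          (adjacent-centres m₁-cand ym₁ ¬centre (inj₁ refl)) (adjacent-centres m₁-cand ym₁ ¬centre (inj₂ refl))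
          (adj-sym cLm₁) (adj-sym cRm₁) (adj-sym cLm₂) (adj-sym cRm₂) ym₁ ym₂ m₁m₂ m₁-free (λ _ → baseFree-B m₂-free _)
          k≤sd y-Bk

      outsider-uniform : ∀ {y x z} → ¬ Candidate y → ¬ Centre y → Candidate x → Candidate z →
                         adj G x z ≡ true → adj G y x ≡ adj G y z
      outsider-uniform {y} {x} {z} ¬cand ¬centre x-cand z-cand xz with adj G y x in yx | adj G y z in yz
      ... | true  | true  = refl
      ... | false | false = refl
      ... | true  | false = ⊥-elim (seesOneEnd ¬cand ¬centre x-cand z-cand xz yx yz)
      ... | false | true  = ⊥-elim (seesOneEnd ¬cand ¬centre z-cand x-cand (adj-sym xz) yz yx)

      nonEdge-¬centre : ∀ {u w} → adj G s u ≡ true → adj G s w ≡ true → u ≢ w → adj G u w ≡ false → ¬ Centre u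
      nonEdge-¬centre {u} {w} su sw u≢w uw u-centre with centre? w
      ... | yes w-centre = clash (centres-adjacent u-centre w-centre u≢w) uw
      ... | no ¬w-centre = clash (adjacent-centres s-candidate (adj-sym sw) ¬w-centre u-centre) (adj-sym uw)

      nonEdge-candidate : ∀ {u w} → adj G s u ≡ true → adj G s w ≡ true → u ≢ w → adj G u w ≡ false → Candidate u
      nonEdge-candidate {u} {w} su sw u≢w uw = byBaseNeighbours (baseFree? u)
        where
        open SmallWindows G (proj₁ reduced)

        ¬centre-u = nonEdge-¬centre su sw u≢w uw
        ¬centre-w = nonEdge-¬centre sw su (≢-sym u≢w) (adj-sym uw)

        sees : ∀ {x} → adj G s x ≡ true → ¬ Centre x → ∀ {c} → Centre c → adj G x c ≡ true
        sees sx ¬centre = adjacent-centres s-candidate (adj-sym sx) ¬centre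

        w-avoids : ∀ {i} → adj G u (B i) ≡ true → adj G w (B i) ≡ false
        w-avoids {i} u-Bi with adj G w (B i) in w-Bi
        ... | false = refl
        ... | true  = ⊥-elim (noHole₄ (u ∷ B i ∷ w ∷ s ∷ []) #0 #1 #2 #3 u≢w (≢-sym (baseFree⇒≢B s-free))
                                u-Bi (adj-sym w-Bi) (adj-sym sw) su uw (adj-sym (baseFree-B s-free i)))

        byBaseNeighbours : Dec (BaseFree u) → Candidate u
        byBaseNeighbours (yes u-free) =
          adj-sym (sees su ¬centre-u (inj₁ refl)) , adj-sym (sees su ¬centre-u (inj₂ refl)) , u-free
        byBaseNeighbours (no ¬free) with baseNeighbour ¬free
        ... | k , k≤sd , u-Bk =
          ⊥-elim (PartialNeighbour.contradiction (proj₁ reduced) u s w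
                    (sees su ¬centre-u (inj₁ refl)) (sees su ¬centre-u (inj₂ refl)) s-cL s-cR
                    (sees sw ¬centre-w (inj₁ refl)) (sees sw ¬centre-w (inj₂ refl))
                    (adj-sym su) uw sw s-free w-avoids k≤sd u-Bk)

      simplicial : Simplicial G s
      simplicial = ModuleArgument.simplicial G reduced s candidate? centre? s-candidate centre-complete
                     outsider-uniform nonEdge-candidate {cL} (λ (cLcL , _) → clash cLcL (irrefl G cL))

-- †-AWs and ‡-AWs

inner-between : ∀ {d i} → 1 ≤ i → i ≤ d → inner d i ≡ true
inner-between {d} {i} 1≤i i≤d =
  cong₂ _∧_ (Equivalence.to Bool.T-≡ (ℕ.≤⇒≤ᵇ 1≤i)) (Equivalence.to Bool.T-≡ (ℕ.≤⇒≤ᵇ i≤d))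

inner-after : ∀ d → inner d (suc d) ≡ false
inner-after d = Bool.¬-not (λ e → ℕ.<-irrefl refl (ℕ.≤ᵇ⇒≤ (suc d) d (Equivalence.from Bool.T-≡ e)))

bD-injective : ∀ {d} {i j : Fin (suc (suc d))} → bD {d} i ≡ bD j → i ≡ j
bD-injective refl = refl

-- The base length is written 3 + e so that its predecessor 2 + e is available.
module DaggerAW (G : Graph) (reduced : Reduced G) (e : ℕ) (f : DagV (3 + e) → Fin (n G))
  (f-injective : Injective _≡_ _≡_ f) (f-induced : ∀ x y → adj G (f x) (f y) ≡ dagAdj (3 + e) x y) where

  open Adjacency G
  open BasePath G (3 + e) (s≤s (s≤s z≤n)) (f ∘ bD) (bD-injective ∘ f-injective) (λ i j → f-induced (bD i) (bD j))

  d = 3 + e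

  2≤d : 2 ≤ d
  2≤d = s≤s (s≤s z≤n)

  c s : V
  c = f cD
  s = f sD

  c-B : ∀ {i} → i ≤ suc d → adj G c (B i) ≡ inner d i
  c-B = B-adj (inner d) (λ k → f-induced cD (bD k))

  c-B-inner : ∀ {i} → 1 ≤ i → i ≤ d → adj G c (B i) ≡ true
  c-B-inner 1≤i i≤d = trans (c-B (ℕ.m≤n⇒m≤1+n i≤d)) (inner-between 1≤i i≤d)

  c-B₀ : adj G c (B 0) ≡ false
  c-B₀ = c-B z≤n

  c-Bₑ : adj G c (B (suc d)) ≡ false
  c-Bₑ = trans (c-B ℕ.≤-refl) (inner-after d)

  open Centres c c c-B₀ c-B-inner c-Bₑ c-B-inner

  module OffCentre (pre : Prereduced G) {y m : V} (c-m : adj G c m ≡ true) (m-free : BaseFree m)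
    (y-m : adj G y m ≡ true) (y≢c : y ≢ c) (y-c : adj G y c ≡ false) where

    open SmallWindows G pre

    m-B : ∀ {i} → adj G m (B i) ≡ false
    m-B = baseFree-B m-free _

    B-m : ∀ {i} → adj G (B i) m ≡ false
    B-m = adj-sym m-B

    y≢B : ∀ {i} → y ≢ B i
    y≢B = separatedBy y-m B-m

    m≢B : ∀ {i} → m ≢ B i
    m≢B = baseFree⇒≢B m-free

    inner-B : ∀ {i} → 1 ≤ i → i ≤ d → adj G y (B i) ≡ false
    inner-B {i} 1≤i i≤d with adj G y (B i) in y-Bi
    ... | false = refl
    ... | true  = ⊥-elim (noHole₄ (y ∷ m ∷ c ∷ B i ∷ []) #0 #1 #2 #3 y≢c m≢B
                            y-m (adj-sym c-m) (c-B-inner 1≤i i≤d) (adj-sym y-Bi) y-c m-B)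

    leftEnd : adj G y (B 0) ≡ true → ⊥
    leftEnd y-B₀ =
      noAsteroidalTriple (B 0 ∷ y ∷ m ∷ B 1 ∷ B 2 ∷ c ∷ B d ∷ []) #0 #2 #4
        (≢-sym m≢B) m≢B (B-injective (s≤s z≤n) 2≤sd) B-m m-B (B-far ℕ.≤-refl 2≤sd)
        (step #1 (adj-sym y-B₀) (inner-B (s≤s z≤n) 2≤d) (step #2 y-m m-B stop))
        (step #3 (B-next z≤n) B-m (step #4 (B-next 1≤d) B-m stop))
        (step #5 (adj-sym c-m) c-B₀ (cL⇝B #6 #4 ℕ.≤-refl 2≤sd))
      where 2≤sd = ℕ.m≤n⇒m≤1+n 2≤d

    rightEnd : adj G y (B (suc d)) ≡ true → ⊥
    rightEnd y-Bₑ =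
      noAsteroidalTriple (B (suc d) ∷ y ∷ m ∷ B d ∷ B (2 + e) ∷ c ∷ B 1 ∷ []) #0 #2 #4
        (≢-sym m≢B) m≢B (≢-sym (B-injective (ℕ.n≤1+n _) ℕ.≤-refl)) B-m m-B (B-far′ ℕ.≤-refl ℕ.≤-refl)
        (step #1 (adj-sym y-Bₑ) (inner-B (s≤s z≤n) (ℕ.n≤1+n _)) (step #2 y-m m-B stop))
        (step #3 (B-prev ℕ.≤-refl) B-m (step #4 (B-prev (ℕ.n≤1+n _)) B-m stop))
        (step #5 (adj-sym c-m) c-Bₑ (cR⇝B #6 #4 ℕ.≤-refl))

    missesBothEnds : adj G y (B 0) ≡ false → adj G y (B (suc d)) ≡ false → ⊥
    missesBothEnds y-B₀ y-Bₑ =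
      noAsteroidalTriple (y ∷ m ∷ c ∷ B 0 ∷ B 1 ∷ B d ∷ B (suc d) ∷ []) #0 #3 #6
        y≢B (B-injective (s≤s z≤n) ℕ.≤-refl) y≢B y-B₀ (B-far (s≤s 1≤d) ℕ.≤-refl) y-Bₑ
        (step #1 y-m m-B (step #2 (adj-sym c-m) c-Bₑ (cR⇝B #4 #3 1≤d)))
        (step #1 y-m m-B (step #2 (adj-sym c-m) c-B₀ (cL⇝B #5 #6 (s≤s 1≤d) ℕ.≤-refl)))
        (step #4 (B-next z≤n) (adj-sym (inner-B ℕ.≤-refl 1≤d)) (step #2 (adj-sym (c-B-inner ℕ.≤-refl 1≤d)) (adj-sym y-c)
          (step #5 (c-B-inner 1≤d ℕ.≤-refl) (adj-sym (inner-B 1≤d ℕ.≤-refl))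
            (step #6 (B-next ℕ.≤-refl) (adj-sym y-Bₑ) stop))))

    contradiction : ⊥
    contradiction with adj G y (B 0) in y-B₀ | adj G y (B (suc d)) in y-Bₑ
    ... | true  | _     = leftEnd y-B₀
    ... | false | true  = rightEnd y-Bₑ
    ... | false | false = missesBothEnds y-B₀ y-Bₑ

  seesCentre : ∀ {y m} → adj G c m ≡ true → BaseFree m → adj G y m ≡ true → y ≢ c → adj G y c ≡ true
  seesCentre c-m m-free y-m y≢c = Bool.¬-not (OffCentre.contradiction (proj₁ reduced) c-m m-free y-m y≢c)

  simplicial : Simplicial G s
  simplicial = ShallowTerminal.simplicial reduced s (f-induced sD cD) (f-induced sD cD) (λ k → f-induced sD (bD k))
                 (inj₁ refl) (λ c-m _ m-free y-m y≢c _ → seesCentre c-m m-free y-m y≢c , seesCentre c-m m-free y-m y≢c)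

bE-injective : ∀ {d} {i j : Fin (suc (suc d))} → bE {d} i ≡ bE j → i ≡ j
bE-injective refl = refl

module DoubleDaggerAW (G : Graph) (reduced : Reduced G) (d : ℕ) (2≤d : 2 ≤ d) (f : DDagV d → Fin (n G))
  (f-injective : Injective _≡_ _≡_ f) (f-induced : ∀ x y → adj G (f x) (f y) ≡ ddagAdj d x y) where

  open Adjacency G
  open BasePath G d 2≤d (f ∘ bE) (bE-injective ∘ f-injective) (λ i j → f-induced (bE i) (bE j))

  c₁ c₂ s : V
  c₁ = f c₁E
  c₂ = f c₂E
  s  = f sE

  c₁-B : ∀ {i} → i ≤ suc d → adj G c₁ (B i) ≡ (inner d i ∨ (i ≡ᵇ 0))
  c₁-B = B-adj (λ i → inner d i ∨ (i ≡ᵇ 0)) (λ k → f-induced c₁E (bE k))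

  c₂-B : ∀ {i} → i ≤ suc d → adj G c₂ (B i) ≡ (inner d i ∨ (i ≡ᵇ suc d))
  c₂-B = B-adj (λ i → inner d i ∨ (i ≡ᵇ suc d)) (λ k → f-induced c₂E (bE k))

  c₁-B-upTo : ∀ {i} → i ≤ d → adj G c₁ (B i) ≡ true
  c₁-B-upTo {zero}  _   = c₁-B z≤n
  c₁-B-upTo {suc i} i≤d = trans (c₁-B (ℕ.m≤n⇒m≤1+n i≤d)) (cong (_∨ false) (inner-between (s≤s z≤n) i≤d))

  c₂-B-from : ∀ {i} → 1 ≤ i → i ≤ suc d → adj G c₂ (B i) ≡ true
  c₂-B-from {i} 1≤i i≤sd with i ℕ.≟ suc d
  ... | yes refl = trans (c₂-B i≤sd) (trans (cong (inner d (suc d) ∨_) (Equivalence.to Bool.T-≡ (ℕ.≡⇒≡ᵇ d d refl)))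
                                            (Bool.∨-zeroʳ _))
  ... | no i≢sd  =
    trans (c₂-B i≤sd) (cong (_∨ (i ≡ᵇ suc d)) (inner-between 1≤i (ℕ.≤-pred (ℕ.≤∧≢⇒< i≤sd i≢sd))))

  c₁-Bₑ : adj G c₁ (B (suc d)) ≡ false
  c₁-Bₑ = trans (c₁-B ℕ.≤-refl) (cong (_∨ false) (inner-after d))

  c₂-B₀ : adj G c₂ (B 0) ≡ false
  c₂-B₀ = c₂-B z≤n

  open Centres c₂ c₁ c₂-B₀ (λ 1≤i i≤d → c₂-B-from 1≤i (ℕ.m≤n⇒m≤1+n i≤d)) c₁-Bₑ (λ _ → c₁-B-upTo)

  module OffCentres (pre : Prereduced G) {y m : V} (c₁-m : adj G c₁ m ≡ true) (c₂-m : adj G c₂ m ≡ true)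
    (m-free : BaseFree m) (y-m : adj G y m ≡ true) (y≢c₁ : y ≢ c₁) (y≢c₂ : y ≢ c₂) where

    open SmallWindows G pre

    m-B : ∀ {i} → adj G m (B i) ≡ false
    m-B = baseFree-B m-free _

    y≢B : ∀ {i} → y ≢ B i
    y≢B = separatedBy y-m (adj-sym m-B)

    m≢B : ∀ {i} → m ≢ B i
    m≢B = baseFree⇒≢B m-free

    2≤sd : 2 ≤ suc d
    2≤sd = ℕ.m≤n⇒m≤1+n 2≤d

    ends : List V
    ends = y ∷ m ∷ c₁ ∷ c₂ ∷ B 0 ∷ B 1 ∷ B d ∷ B (suc d) ∷ []

    missesBothEnds : adj G y (B 0) ≡ false → adj G y (B (suc d)) ≡ false →
                     Avoiding G (_∈ᴸ ends) y (B 0) (B (suc d)) → ⊥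
    missesBothEnds y-B₀ y-Bₑ B₀⇝Bₑ =
      noAsteroidalTriple ends #0 #4 #7
        y≢B (B-injective (s≤s z≤n) ℕ.≤-refl) y≢B y-B₀ (B-far 2≤sd ℕ.≤-refl) y-Bₑ
        (step #1 y-m m-B (step #2 (adj-sym c₁-m) c₁-Bₑ (step #4 (c₁-B-upTo z≤n) (B-far 2≤sd ℕ.≤-refl) stop)))
        (step #1 y-m m-B (step #3 (adj-sym c₂-m) c₂-B₀
          (step #7 (c₂-B-from (s≤s z≤n) ℕ.≤-refl) (B-far′ 2≤sd ℕ.≤-refl) stop)))
        B₀⇝Bₑ

    missesB-c₁ : adj G y c₁ ≡ false → ∀ {i} → i ≤ d → adj G y (B i) ≡ false
    missesB-c₁ y-c₁ {i} i≤d with adj G y (B i) in y-Bi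
    ... | false = refl
    ... | true  = ⊥-elim (noHole₄ (y ∷ m ∷ c₁ ∷ B i ∷ []) #0 #1 #2 #3 y≢c₁ m≢B
                            y-m (adj-sym c₁-m) (c₁-B-upTo i≤d) (adj-sym y-Bi) y-c₁ m-B)

    missesB-c₂ : adj G y c₂ ≡ false → ∀ {i} → 1 ≤ i → i ≤ suc d → adj G y (B i) ≡ false
    missesB-c₂ y-c₂ {i} 1≤i i≤sd with adj G y (B i) in y-Bi
    ... | false = refl
    ... | true  = ⊥-elim (noHole₄ (y ∷ m ∷ c₂ ∷ B i ∷ []) #0 #1 #2 #3 y≢c₂ m≢B
                            y-m (adj-sym c₂-m) (c₂-B-from 1≤i i≤sd) (adj-sym y-Bi) y-c₂ m-B)

    sees-c₁ : adj G y c₁ ≡ false → ⊥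
    sees-c₁ y-c₁ with adj G y (B (suc d)) in y-Bₑ
    ... | true  = noHole₅ (y ∷ B (suc d) ∷ B d ∷ c₁ ∷ m ∷ []) #0 #1 #2 #3 #4 y≢B
                    y-Bₑ (B-prev ℕ.≤-refl) (adj-sym (c₁-B-upTo ℕ.≤-refl)) c₁-m (adj-sym y-m)
                    (missesB-c₁ y-c₁ ℕ.≤-refl) m-B c₁-Bₑ
    ... | false = missesBothEnds (missesB-c₁ y-c₁ z≤n) y-Bₑ
                    (step #2 (adj-sym (c₁-B-upTo z≤n)) (adj-sym y-c₁)
                      (step #6 (c₁-B-upTo ℕ.≤-refl) (adj-sym (missesB-c₁ y-c₁ ℕ.≤-refl))
                        (step #7 (B-next ℕ.≤-refl) (adj-sym y-Bₑ) stop)))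

    sees-c₂ : adj G y c₂ ≡ false → ⊥
    sees-c₂ y-c₂ with adj G y (B 0) in y-B₀
    ... | true  = noHole₅ (y ∷ B 0 ∷ B 1 ∷ c₂ ∷ m ∷ []) #0 #1 #2 #3 #4 y≢B
                    y-B₀ (B-next z≤n) (adj-sym (c₂-B-from ℕ.≤-refl (s≤s z≤n))) c₂-m (adj-sym y-m)
                    (missesB-c₂ y-c₂ ℕ.≤-refl (s≤s z≤n)) m-B c₂-B₀
    ... | false = missesBothEnds y-B₀ (missesB-c₂ y-c₂ (s≤s z≤n) ℕ.≤-refl)
                    (step #5 (B-next z≤n) (adj-sym (missesB-c₂ y-c₂ ℕ.≤-refl (s≤s z≤n)))
                      (step #3 (adj-sym (c₂-B-from ℕ.≤-refl (s≤s z≤n))) (adj-sym y-c₂)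
                        (step #7 (c₂-B-from (s≤s z≤n) ℕ.≤-refl)
                          (adj-sym (missesB-c₂ y-c₂ (s≤s z≤n) ℕ.≤-refl)) stop)))

  simplicial : Simplicial G s
  simplicial = ShallowTerminal.simplicial reduced s (f-induced sE c₂E) (f-induced sE c₁E) (λ k → f-induced sE (bE k))
                 (inj₂ (f-induced c₂E c₁E))
                 (λ c₂-m c₁-m m-free y-m y≢c₂ y≢c₁ →
                    Bool.¬-not (OffCentres.sees-c₂ (proj₁ reduced) c₁-m c₂-m m-free y-m y≢c₁ y≢c₂) ,
                    Bool.¬-not (OffCentres.sees-c₁ (proj₁ reduced) c₁-m c₂-m m-free y-m y≢c₁ y≢c₂))

theorem2p1 : (G : Graph) → Reduced G → ∀ s → ShallowTerminal G s → Simplicial G s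
theorem2p1 G reduced _ (inj₁ (_ , s≤s (s≤s (s≤s _)) , f , (f-injective , f-induced) , refl)) =
  DaggerAW.simplicial G reduced _ f f-injective f-induced
theorem2p1 G reduced _ (inj₂ (d , 2≤d , f , (f-injective , f-induced) , refl)) =
  DoubleDaggerAW.simplicial G reduced d 2≤d f f-injective f-induced
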